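{- For every term $t$ and substitutions $\rho,\sigma$ with $t\rho\sigma$ ground, $\langle t\rho,\sigma\rangle\succeq_{tc}\langle t,\rho\sigma\rangle$ (where $\succeq$ means $\succ$ or equal). Analogously, for literals $L$ with $L\rho\sigma$ ground, $\langle L\rho,\sigma\rangle\succeq_{lc}\langle L,\rho\sigma\rangle$, and for clauses $C$ with $C\rho\sigma$ ground, $\langle C\rho,\sigma\rangle\succeq_{cc}\langle C,\rho\sigma\rangle$. In particular $\langle t\sigma,id\rangle\succeq_{tc}\langle t,\sigma\rangle$, and analogously for literals and clauses.
   Context: Fix a first-order signature with equality as the only predicate; literals are unordered pairs of terms with a polarity ($s\approx t$ or $s\not\approx t$), clauses are finite multisets of literals; $id$ is the identity substitution. Fix a reduction ordering $\succ_t$ on terms, total on ground terms. For an ordering $\succ$, its multiset extension $\succ\!\succ$: $A\succ\!\succ B$ iff $A\ne B$ and for every $x$ with $B(x)>A(x)$ there is $y\succ x$ with $A(y)>B(y)$. $s\sqsupset t$ ($s$ less general than $t$) means $t\sigma=s$ for some $\sigma$ but no $\rho$ has $s\rho=t$. A closure $\langle e,\sigma\rangle$ represents $e\sigma$; it is ground if $e\sigma$ is ground. On ground term closures, $\langle s,\sigma\rangle\succ_{tc}\langle t,\rho\rangle$ iff $s\sigma\succ_t t\rho$, or $s\sigma=t\rho$ and $s\sqsupset t$; extended to an arbitrary fixed total well-founded order, still $\succ_{tc}$. $M_{lc}(\langle s\approx t,\theta\rangle)=\{\langle s,\theta\rangle,\langle t,\theta\rangle\}$, $M_{lc}(\langle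 s\not\approx t,\theta\rangle)=\{\langle s,\theta\rangle,\langle s\theta,id\rangle,\langle t,\theta\rangle,\langle t\theta,id\rangle\}$, $\langle L,\sigma\rangle\succ_{lc}\langle L',\rho\rangle$ iff $M_{lc}(\cdot)\succ\!\succ_{tc}M_{lc}(\cdot)$. $M_{cc}(\langle C,\sigma\rangle)=\{\langle L,\sigma\rangle\}$ if $C=\{L\}$, else $\{\langle L\sigma,id\rangle\mid L\in C\}$; $\langle C,\sigma\rangle\succ_{cc}\langle D,\rho\rangle$ iff $M_{cc}(\cdot)\succ\!\succ_{lc}M_{cc}(\cdot)$. -}

module Defs where

open import Data.Nat using (ℕ; zero; suc; _<_)
open import Data.Fin using (Fin)
open import Data.Vec using (Vec; []; _∷_; lookup; _[_]≔_)
open import Data.List using (List; []; _∷_; map)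
open import Data.List.Relation.Unary.All using (All)
open import Data.Product using (Σ; ∃; ∃-syntax; _×_; _,_)
open import Data.Sum using (_⊎_)
open import Relation.Nullary using (¬_)
open import Relation.Binary.PropositionalEquality using (_≡_)
open import Function using (flip)
open import Induction.WellFounded using (WellFounded)

-- First-order signature (equality is the only predicate, so only
-- function symbols are needed).  Variables are natural numbers.

record Signature : Set₁ where
  field
    Fun   : Set
    arity : Fun → ℕ

-- Generic finite multisets (as lists) modulo an equivalence _≈_,
-- and the multiset extension of an ordering _≻_ (paper's definition,
-- via multiplicities A(x)).

module Multiset {A : Set} (_≈_ : A → A → Set) (_≻_ : A → A → Set) where

  data Count (x : A) : List A → ℕ → Set where
    nil  : Count x [] 0
    hit  : ∀ {y ys n} → y ≈ x → Count x ys n → Count x (y ∷ ys) (suc n)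
    miss : ∀ {y ys n} → ¬ (y ≈ x) → Count x ys n → Count x (y ∷ ys) n

  _≈ₘ_ : List A → List A → Set
  M ≈ₘ N = ∀ x n m → Count x M n → Count x N m → n ≡ m

  _≻≻_ : List A → List A → Set
  M ≻≻ N =
    ¬ (M ≈ₘ N) ×
    (∀ x n m → Count x N n → Count x M m → m < n →
       ∃[ y ] (y ≻ x × ∃[ k ] ∃[ l ] (Count y M k × Count y N l × l < k)))

module Terms (S : Signature) where
  open Signature S

  data Term : Set where
    var : ℕ → Term
    fun : (f : Fun) → Vec Term (arity f) → Term

  Subst : Set
  Subst = ℕ → Term

  id : Subst
  id = var

  mutual
    _⟪_⟫ : Term → Subst → Term
    var x ⟪ σ ⟫ = σ x
    fun f ts ⟪ σ ⟫ = fun f (ts ⟪ σ ⟫*)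

    _⟪_⟫* : ∀ {n} → Vec Term n → Subst → Vec Term n
    [] ⟪ σ ⟫* = []
    (t ∷ ts) ⟪ σ ⟫* = (t ⟪ σ ⟫) ∷ (ts ⟪ σ ⟫*)

  -- composition: (ρ ⨾ σ) applies ρ first, then σ  (written ρσ in the paper)
  _⨾_ : Subst → Subst → Subst
  (ρ ⨾ σ) x = ρ x ⟪ σ ⟫

  data _occursIn_ (x : ℕ) : Term → Set where
    here   : x occursIn var x
    inside : ∀ {f ts} (i : Fin (arity f)) → x occursIn lookup ts i → x occursIn fun f ts

  Ground : Term → Set
  Ground t = ∀ x → ¬ (x occursIn t)

  _⊐_ : Term → Term → Set
  s ⊐ t = (∃[ σ ] (t ⟪ σ ⟫ ≡ s)) × ¬ (∃[ ρ ] (s ⟪ ρ ⟫ ≡ t))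

  Variant : Term → Term → Set
  Variant s t = (∃[ σ ] (t ⟪ σ ⟫ ≡ s)) × (∃[ ρ ] (s ⟪ ρ ⟫ ≡ t))

  -- literals: s ≈ t (pos) or s ≉ t (neg); clauses: finite multisets (lists)
  data Literal : Set where
    pos : Term → Term → Literal
    neg : Term → Term → Literal

  _⟪_⟫ₗ : Literal → Subst → Literal
  pos s t ⟪ σ ⟫ₗ = pos (s ⟪ σ ⟫) (t ⟪ σ ⟫)
  neg s t ⟪ σ ⟫ₗ = neg (s ⟪ σ ⟫) (t ⟪ σ ⟫)

  GroundL : Literal → Set
  GroundL (pos s t) = Ground s × Ground t
  GroundL (neg s t) = Ground s × Ground t

  Clause : Set
  Clause = List Literal

  _⟪_⟫c : Clause → Subst → Clause
  C ⟪ σ ⟫c = map (λ L → L ⟪ σ ⟫ₗ) C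

  GroundC : Clause → Set
  GroundC C = All GroundL C

  TermClosure : Set
  TermClosure = Term × Subst

  LitClosure : Set
  LitClosure = Literal × Subst

  ClauseClosure : Set
  ClauseClosure = Clause × Subst

  GroundTC : TermClosure → Set
  GroundTC (s , σ) = Ground (s ⟪ σ ⟫)

  _≈tc_ : TermClosure → TermClosure → Set
  (s , σ) ≈tc (t , ρ) = (s ⟪ σ ⟫ ≡ t ⟪ ρ ⟫) × Variant s t

  record ReductionOrdering : Set₁ where
    field
      _≻_      : Term → Term → Set
      irrefl   : ∀ {s} → ¬ (s ≻ s)
      trans    : ∀ {s t u} → s ≻ t → t ≻ u → s ≻ u
      wf       : WellFounded (flip _≻_)
      compat   : ∀ f (ts : Vec Term (arity f)) (i : Fin (arity f)) {s t} →
                 s ≻ t → fun f (ts [ i ]≔ s) ≻ fun f (ts [ i ]≔ t)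
      stable   : ∀ {s t} (σ : Subst) → s ≻ t → (s ⟪ σ ⟫) ≻ (t ⟪ σ ⟫)
      total    : ∀ {s t} → Ground s → Ground t → s ≡ t ⊎ s ≻ t ⊎ t ≻ s

  module _ (ro : ReductionOrdering) where
    open ReductionOrdering ro

    BaseTC : TermClosure → TermClosure → Set
    BaseTC (s , σ) (t , ρ) =
      GroundTC (s , σ) × GroundTC (t , ρ) ×
      ((s ⟪ σ ⟫) ≻ (t ⟪ ρ ⟫) ⊎ ((s ⟪ σ ⟫ ≡ t ⟪ ρ ⟫) × s ⊐ t))

    record ClosureOrdering : Set₁ where
      field
        _≻tc_   : TermClosure → TermClosure → Set
        extends : ∀ {x y} → BaseTC x y → x ≻tc y
        ground  : ∀ {x y} → x ≻tc y → GroundTC x × GroundTC y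
        irrefl  : ∀ {x y} → x ≈tc y → ¬ (x ≻tc y)
        trans   : ∀ {x y z} → x ≻tc y → y ≻tc z → x ≻tc z
        resp    : ∀ {x x′ y y′} → x ≈tc x′ → y ≈tc y′ → x ≻tc y → x′ ≻tc y′
        total   : ∀ {x y} → GroundTC x → GroundTC y → x ≈tc y ⊎ x ≻tc y ⊎ y ≻tc x
        wf      : WellFounded (flip _≻tc_)

  module ClosureOrders (ro : ReductionOrdering) (co : ClosureOrdering ro) where
    open ClosureOrdering co public

    _⪰tc_ : TermClosure → TermClosure → Set
    x ⪰tc y = x ≻tc y ⊎ x ≈tc y

    Mlc : LitClosure → List TermClosure
    Mlc (pos s t , θ) = (s , θ) ∷ (t , θ) ∷ []
    Mlc (neg s t , θ) = (s , θ) ∷ (s ⟪ θ ⟫ , id) ∷ (t , θ) ∷ (t ⟪ θ ⟫ , id) ∷ []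

    open Multiset _≈tc_ _≻tc_ renaming (_≈ₘ_ to _≈ₘtc_; _≻≻_ to _≻≻tc_)

    _≻lc_ : LitClosure → LitClosure → Set
    x ≻lc y = Mlc x ≻≻tc Mlc y

    _≈lc_ : LitClosure → LitClosure → Set
    x ≈lc y = Mlc x ≈ₘtc Mlc y

    _⪰lc_ : LitClosure → LitClosure → Set
    x ⪰lc y = x ≻lc y ⊎ x ≈lc y

    Mcc : ClauseClosure → List LitClosure
    Mcc (L ∷ [] , σ) = (L , σ) ∷ []
    Mcc (C , σ) = map (λ L → (L ⟪ σ ⟫ₗ , id)) C

    open Multiset _≈lc_ _≻lc_ renaming (_≈ₘ_ to _≈ₘlc_; _≻≻_ to _≻≻lc_)

    _≻cc_ : ClauseClosure → ClauseClosure → Set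
    x ≻cc y = Mcc x ≻≻lc Mcc y

    _≈cc_ : ClauseClosure → ClauseClosure → Set
    x ≈cc y = Mcc x ≈ₘlc Mcc y

    _⪰cc_ : ClauseClosure → ClauseClosure → Set
    x ⪰cc y = x ≻cc y ⊎ x ≈cc y

{-# OPTIONS --safe #-}
module Submission where

-- The closures ⟨tρ, σ⟩ and ⟨t, ρσ⟩ represent the same ground term and tρ is an instance
-- of t, so by totality they are either identical (tρ and t are variants) or tρ ⊐ t, in
-- which case ⟨tρ, σ⟩ ≻tc ⟨t, ρσ⟩ by definition.  The M_lc multisets of ⟨Lρ, σ⟩ and
-- ⟨L, ρσ⟩ are related position by position by ⪰tc, and such a pointwise relation lifts to
-- the multiset extension: the greatest left element u of a strictly decreasing position
-- occurs more often on the left than on the right, and dominates everything that occurs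
-- more often on the right.  For a clause with at least two literals both M_cc multisets
-- consist of the closures ⟨Lρσ, id⟩; a unit clause reduces to its literal.  All results
-- are proved for any θ with ρσ ≗ θ, so that the cases with id follow from σ id ≗ σ.

open import Defs
open import Data.Empty using (⊥; ⊥-elim)
open import Data.Fin using (zero; suc)
open import Data.List using (List; []; _∷_; [_]; map)
open import Data.List.Properties using (map-∘; map-cong)
open import Data.List.Relation.Binary.Pointwise using (Pointwise; []; _∷_)
open import Data.List.Relation.Unary.All as All using (All; []; _∷_)
open import Data.Nat using (suc; _<_; _≤_; z≤n; s≤s)
open import Data.Nat.Properties using (<-irrefl; <⇒≤; m≤n⇒m≤1+n)
open import Data.Product using (_×_; _,_; proj₁; proj₂; ∃-syntax)
open import Data.Sum as ⊎ using (_⊎_; inj₁; inj₂)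
open import Data.Unit using (⊤; tt)
open import Data.Vec using (Vec; []; _∷_; lookup)
open import Function using (_∘_)
open import Level using (0ℓ)
open import Relation.Binary.Core using (Rel)
open import Relation.Binary.Definitions using (Reflexive; Transitive; Irreflexive)
open import Relation.Binary.Structures using (IsEquivalence)
open import Relation.Binary.PropositionalEquality
  using (_≡_; _≗_; refl; sym; trans; cong; cong₂; subst)
open import Relation.Nullary using (¬_; Dec; yes; no)
open import Relation.Nullary.Decidable using (map′)

module MultisetProperties {A : Set} (_≈_ _≻_ : Rel A 0ℓ) where
  open Multiset _≈_ _≻_ public

  SurplusDominates : List A → List A → Set
  SurplusDominates M N =
    ∀ x n m → Count x N n → Count x M m → m < n →
    ∃[ y ] (y ≻ x × ∃[ k ] ∃[ l ] (Count y M k × Count y N l × l < k))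

  count-unique : ∀ {x M m n} → Count x M m → Count x M n → m ≡ n
  count-unique nil          nil          = refl
  count-unique (hit _ c)    (hit _ d)    = cong suc (count-unique c d)
  count-unique (hit y≈x _)  (miss y≉x _) = ⊥-elim (y≉x y≈x)
  count-unique (miss y≉x _) (hit y≈x _)  = ⊥-elim (y≉x y≈x)
  count-unique (miss _ c)   (miss _ d)   = count-unique c d

  count : ∀ {x M} → All (λ y → Dec (y ≈ x)) M → ∃[ n ] Count x M n
  count []             = 0 , nil
  count (yes y≈x ∷ ds) = let n , c = count ds in suc n , hit y≈x c
  count (no y≉x ∷ ds)  = let n , c = count ds in n , miss y≉x c

  ≈ₘ-reflexive : ∀ {M N} → M ≡ N → M ≈ₘ N
  ≈ₘ-reflexive refl _ _ _ = count-unique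

  ≈ₘ-sym : ∀ {M N} → M ≈ₘ N → N ≈ₘ M
  ≈ₘ-sym M≈N x n m c d = sym (M≈N x m n d c)

  ≈ₘ-trans : ∀ {M N P} → (∀ x → ∃[ n ] Count x N n) → M ≈ₘ N → N ≈ₘ P → M ≈ₘ P
  ≈ₘ-trans count-N M≈N N≈P x m p cM cP =
    let n , cN = count-N x in trans (M≈N x m n cM cN) (N≈P x n p cN cP)

  ≻≻-respʳ-≈ₘ : ∀ {M N P} → (∀ x → ∃[ n ] Count x N n) →
                (∀ {y x} → y ≻ x → ∃[ n ] Count y P n) →
                M ≻≻ N → N ≈ₘ P → ¬ M ≈ₘ P → M ≻≻ P
  ≻≻-respʳ-≈ₘ {M} {N} {P} count-N count-P (_ , dominated) N≈P M≉P = M≉P , dominated′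
    where
    dominated′ : SurplusDominates M P
    dominated′ x p m cP cM m<p with count-N x
    ... | n , cN with dominated x n m cN cM (subst (m <_) (sym (N≈P x n p cN cP)) m<p)
    ... | y , y≻x , k , l , cyM , cyN , l<k with count-P y≻x
    ... | l′ , cyP = y , y≻x , k , l′ , cyM , cyP , subst (_< k) (N≈P y l l′ cyN cyP) l<k

  singleton-≈ₘ : ∀ {x y} → (∀ {u} → x ≈ u → y ≈ u) → (∀ {u} → y ≈ u → x ≈ u) →
                 [ x ] ≈ₘ [ y ]
  singleton-≈ₘ x→y y→x u _ _ (hit _ nil)      (hit _ nil)      = refl
  singleton-≈ₘ x→y y→x u _ _ (hit x≈u nil)    (miss y≉u nil)   = ⊥-elim (y≉u (x→y x≈u))
  singleton-≈ₘ x→y y→x u _ _ (miss x≉u nil)   (hit y≈u nil)    = ⊥-elim (x≉u (y→x y≈u))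
  singleton-≈ₘ x→y y→x u _ _ (miss _ nil)     (miss _ nil)     = refl

  singleton-≻≻ : ∀ {x y} → Reflexive _≈_ → ¬ x ≈ y → ¬ y ≈ x →
                 (∀ {z} → y ≈ z → ¬ x ≈ z → x ≻ z) → [ x ] ≻≻ [ y ]
  singleton-≻≻ {x} {y} ≈-refl x≉y y≉x x≻ = differ , dominated
    where
    differ : ¬ [ x ] ≈ₘ [ y ]
    differ x≈y with x≈y y 0 1 (miss x≉y nil) (hit ≈-refl nil)
    ... | ()
    dominated : SurplusDominates [ x ] [ y ]
    dominated z _ _ (hit y≈z nil) (miss x≉z nil) _ =
      x , x≻ y≈z x≉z , 1 , 0 , hit ≈-refl nil , miss y≉x nil , s≤s z≤n
    dominated z _ _ (hit _ nil) (hit _ nil) (s≤s ())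
    dominated z _ _ (miss _ nil) _ ()

module PointwiseDomination
  {A : Set} (_≈_ _≻_ : Rel A 0ℓ) (G : A → Set)
  (≈-equiv : IsEquivalence _≈_)
  (≻-trans : Transitive _≻_)
  (≻-irrefl : Irreflexive _≈_ _≻_)
  (≻-resp : ∀ {x x′ y y′} → x ≈ x′ → y ≈ y′ → x ≻ y → x′ ≻ y′)
  (≻-total : ∀ {x y} → G x → G y → x ≈ y ⊎ x ≻ y ⊎ y ≻ x)
  where
  open IsEquivalence ≈-equiv renaming (refl to ≈-refl; sym to ≈-sym; trans to ≈-trans)
  open Multiset _≈_ _≻_

  _⪰_ : Rel A 0ℓ
  x ⪰ y = x ≻ y ⊎ x ≈ y

  ⪰-≻-trans : ∀ {x y z} → x ⪰ y → y ≻ z → x ≻ z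
  ⪰-≻-trans (inj₁ x≻y) y≻z = ≻-trans x≻y y≻z
  ⪰-≻-trans (inj₂ x≈y) y≻z = ≻-resp (≈-sym x≈y) ≈-refl y≻z

  ≻-⪰-trans : ∀ {x y z} → x ≻ y → y ⪰ z → x ≻ z
  ≻-⪰-trans x≻y (inj₁ y≻z) = ≻-trans x≻y y≻z
  ≻-⪰-trans x≻y (inj₂ y≈z) = ≻-resp ≈-refl y≈z x≻y

  below-≉ : ∀ {u a b} → u ⪰ a → a ≻ b → ¬ b ≈ u
  below-≉ u⪰a a≻b b≈u = ≻-irrefl ≈-refl (≻-resp ≈-refl b≈u (⪰-≻-trans u⪰a a≻b))

  ≈? : ∀ {x y} → G x → G y → Dec (x ≈ y)
  ≈? gx gy with ≻-total gx gy
  ... | inj₁ x≈y        = yes x≈y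
  ... | inj₂ (inj₁ x≻y) = no λ x≈y → ≻-irrefl x≈y x≻y
  ... | inj₂ (inj₂ y≻x) = no λ x≈y → ≻-irrefl (≈-sym x≈y) y≻x

  Uniform : ∀ {M N} → Pointwise _⪰_ M N → Set
  Uniform []              = ⊤
  Uniform (inj₁ _ ∷ _)    = ⊥
  Uniform (inj₂ _ ∷ ps)   = Uniform ps

  Bounds : ∀ {M N} → A → Pointwise _⪰_ M N → Set
  Bounds u []                        = ⊤
  Bounds u (_∷_ {x = a} (inj₁ _) ps) = u ⪰ a × Bounds u ps
  Bounds u (inj₂ _ ∷ ps)             = Bounds u ps

  StrictLeft : ∀ {M N} → A → Pointwise _⪰_ M N → Set
  StrictLeft u []                        = ⊥
  StrictLeft u (_∷_ {x = a} (inj₁ _) ps) = a ≈ u ⊎ StrictLeft u ps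
  StrictLeft u (inj₂ _ ∷ ps)             = StrictLeft u ps

  StrictRight : ∀ {M N} → A → Pointwise _⪰_ M N → Set
  StrictRight u []                        = ⊥
  StrictRight u (_∷_ {y = b} (inj₁ _) ps) = b ≈ u ⊎ StrictRight u ps
  StrictRight u (inj₂ _ ∷ ps)             = StrictRight u ps

  uniform⇒≈ₘ : ∀ {M N} (ps : Pointwise _⪰_ M N) → Uniform ps → M ≈ₘ N
  uniform⇒≈ₘ [] _ x _ _ nil nil = refl
  uniform⇒≈ₘ (inj₂ a≈b ∷ ps) uni x _ _ (hit _ cM) (hit _ cN) =
    cong suc (uniform⇒≈ₘ ps uni x _ _ cM cN)
  uniform⇒≈ₘ (inj₂ a≈b ∷ ps) uni x _ _ (hit a≈x _) (miss b≉x _) =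
    ⊥-elim (b≉x (≈-trans (≈-sym a≈b) a≈x))
  uniform⇒≈ₘ (inj₂ a≈b ∷ ps) uni x _ _ (miss a≉x _) (hit b≈x _) =
    ⊥-elim (a≉x (≈-trans a≈b b≈x))
  uniform⇒≈ₘ (inj₂ a≈b ∷ ps) uni x _ _ (miss _ cM) (miss _ cN) =
    uniform⇒≈ₘ ps uni x _ _ cM cN

  uniform⇒bounds : ∀ {M N u} (ps : Pointwise _⪰_ M N) → Uniform ps → Bounds u ps
  uniform⇒bounds []            _   = tt
  uniform⇒bounds (inj₂ _ ∷ ps) uni = uniform⇒bounds ps uni

  bounds-≻-mono : ∀ {M N u v} (ps : Pointwise _⪰_ M N) → u ≻ v → Bounds v ps → Bounds u ps
  bounds-≻-mono []            u≻v _               = tt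
  bounds-≻-mono (inj₁ _ ∷ ps) u≻v (v⪰a , bounds) = inj₁ (≻-⪰-trans u≻v v⪰a) , bounds-≻-mono ps u≻v bounds
  bounds-≻-mono (inj₂ _ ∷ ps) u≻v bounds          = bounds-≻-mono ps u≻v bounds

  strict-maximum : ∀ {M N} → All G M → (ps : Pointwise _⪰_ M N) →
                   Uniform ps ⊎ ∃[ u ] (G u × Bounds u ps × StrictLeft u ps)
  strict-maximum [] [] = inj₁ tt
  strict-maximum (_ ∷ gM) (inj₂ _ ∷ ps) = strict-maximum gM ps
  strict-maximum (ga ∷ gM) (inj₁ _ ∷ ps) with strict-maximum gM ps
  ... | inj₁ uni = inj₂ (_ , ga , (inj₂ ≈-refl , uniform⇒bounds ps uni) , inj₁ ≈-refl)
  ... | inj₂ (v , gv , bounds , left) with ≻-total ga gv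
  ...   | inj₁ a≈v        = inj₂ (v , gv , (inj₂ (≈-sym a≈v) , bounds) , inj₂ left)
  ...   | inj₂ (inj₁ a≻v) = inj₂ (_ , ga , (inj₂ ≈-refl , bounds-≻-mono ps a≻v bounds) , inj₁ ≈-refl)
  ...   | inj₂ (inj₂ v≻a) = inj₂ (v , gv , (inj₁ v≻a , bounds) , inj₂ left)

  count-bounds : ∀ {M N u} → All G M → G u → (ps : Pointwise _⪰_ M N) → Bounds u ps →
                 ∃[ m ] ∃[ n ] (Count u M m × Count u N n × n ≤ m × (StrictLeft u ps → n < m))
  count-bounds [] gu [] _ = 0 , 0 , nil , nil , z≤n , λ ()
  count-bounds (ga ∷ gM) gu (inj₂ a≈b ∷ ps) bounds
    with count-bounds gM gu ps bounds | ≈? ga gu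
  ... | m , n , cM , cN , n≤m , gap | yes a≈u =
    suc m , suc n , hit a≈u cM , hit (≈-trans (≈-sym a≈b) a≈u) cN , s≤s n≤m , s≤s ∘ gap
  ... | m , n , cM , cN , n≤m , gap | no a≉u =
    m , n , miss a≉u cM , miss (a≉u ∘ ≈-trans a≈b) cN , n≤m , gap
  count-bounds (ga ∷ gM) gu (inj₁ a≻b ∷ ps) (u⪰a , bounds)
    with count-bounds gM gu ps bounds | ≈? ga gu
  ... | m , n , cM , cN , n≤m , gap | yes a≈u =
    suc m , n , hit a≈u cM , miss (below-≉ u⪰a a≻b) cN , m≤n⇒m≤1+n n≤m , λ _ → s≤s n≤m
  ... | m , n , cM , cN , n≤m , gap | no a≉u =
    m , n , miss a≉u cM , miss (below-≉ u⪰a a≻b) cN , n≤m , ⊎.[ ⊥-elim ∘ a≉u , gap ]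

  deficit⇒strictRight : ∀ {M N x m n} (ps : Pointwise _⪰_ M N) →
                        Count x M m → Count x N n → m < n → StrictRight x ps
  deficit⇒strictRight (inj₁ _ ∷ ps) _ (hit b≈x _) _ = inj₁ b≈x
  deficit⇒strictRight (inj₁ _ ∷ ps) (hit _ cM) (miss _ cN) 1+m<n =
    inj₂ (deficit⇒strictRight ps cM cN (<⇒≤ 1+m<n))
  deficit⇒strictRight (inj₁ _ ∷ ps) (miss _ cM) (miss _ cN) m<n =
    inj₂ (deficit⇒strictRight ps cM cN m<n)
  deficit⇒strictRight (inj₂ _ ∷ ps) (hit _ cM) (hit _ cN) (s≤s m<n) =
    deficit⇒strictRight ps cM cN m<n
  deficit⇒strictRight (inj₂ a≈b ∷ ps) (hit a≈x _) (miss b≉x _) _ =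
    ⊥-elim (b≉x (≈-trans (≈-sym a≈b) a≈x))
  deficit⇒strictRight (inj₂ a≈b ∷ ps) (miss a≉x _) (hit b≈x _) _ =
    ⊥-elim (a≉x (≈-trans a≈b b≈x))
  deficit⇒strictRight (inj₂ _ ∷ ps) (miss _ cM) (miss _ cN) m<n =
    deficit⇒strictRight ps cM cN m<n

  bounds-strictRight : ∀ {M N u x} (ps : Pointwise _⪰_ M N) →
                       Bounds u ps → StrictRight x ps → u ≻ x
  bounds-strictRight (inj₁ a≻b ∷ ps) (u⪰a , _) (inj₁ b≈x) =
    ≻-resp ≈-refl b≈x (⪰-≻-trans u⪰a a≻b)
  bounds-strictRight (inj₁ _ ∷ ps) (_ , bounds) (inj₂ right) = bounds-strictRight ps bounds right
  bounds-strictRight (inj₂ _ ∷ ps) bounds right = bounds-strictRight ps bounds right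

  pointwise-⪰⇒≻≻⊎≈ₘ : ∀ {M N} → All G M → Pointwise _⪰_ M N → M ≻≻ N ⊎ M ≈ₘ N
  pointwise-⪰⇒≻≻⊎≈ₘ gM ps with strict-maximum gM ps
  ... | inj₁ uni = inj₂ (uniform⇒≈ₘ ps uni)
  ... | inj₂ (u , gu , bounds , left) with count-bounds gM gu ps bounds
  ...   | m , n , cM , cN , _ , gap =
    inj₁ ( (λ M≈N → <-irrefl (sym (M≈N u m n cM cN)) (gap left))
         , λ x _ _ cxN cxM deficit →
             u , bounds-strictRight ps bounds (deficit⇒strictRight ps cxM cxN deficit) ,
             m , n , cM , cN , gap left )

module Substitution (S : Signature) where
  open Signature S
  open Terms S

  mutual
    ⟪⟫-⨾ : ∀ {ρ σ θ} → ρ ⨾ σ ≗ θ → ∀ t → (t ⟪ ρ ⟫) ⟪ σ ⟫ ≡ t ⟪ θ ⟫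
    ⟪⟫-⨾ eq (var x)    = eq x
    ⟪⟫-⨾ eq (fun f ts) = cong (fun f) (⟪⟫*-⨾ eq ts)

    ⟪⟫*-⨾ : ∀ {ρ σ θ n} → ρ ⨾ σ ≗ θ → (ts : Vec Term n) → (ts ⟪ ρ ⟫*) ⟪ σ ⟫* ≡ ts ⟪ θ ⟫*
    ⟪⟫*-⨾ eq []       = refl
    ⟪⟫*-⨾ eq (t ∷ ts) = cong₂ _∷_ (⟪⟫-⨾ eq t) (⟪⟫*-⨾ eq ts)

  mutual
    ⟪id⟫ : ∀ t → t ⟪ id ⟫ ≡ t
    ⟪id⟫ (var x)    = refl
    ⟪id⟫ (fun f ts) = cong (fun f) (⟪id⟫* ts)

    ⟪id⟫* : ∀ {n} (ts : Vec Term n) → ts ⟪ id ⟫* ≡ ts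
    ⟪id⟫* []       = refl
    ⟪id⟫* (t ∷ ts) = cong₂ _∷_ (⟪id⟫ t) (⟪id⟫* ts)

  ⨾-identityʳ : ∀ σ → σ ⨾ id ≗ σ
  ⨾-identityʳ σ x = ⟪id⟫ (σ x)

  ⟪⟫ₗ-⨾ : ∀ {ρ σ θ} → ρ ⨾ σ ≗ θ → ∀ L → (L ⟪ ρ ⟫ₗ) ⟪ σ ⟫ₗ ≡ L ⟪ θ ⟫ₗ
  ⟪⟫ₗ-⨾ eq (pos s t) = cong₂ pos (⟪⟫-⨾ eq s) (⟪⟫-⨾ eq t)
  ⟪⟫ₗ-⨾ eq (neg s t) = cong₂ neg (⟪⟫-⨾ eq s) (⟪⟫-⨾ eq t)

  ⟪⟫c-⨾ : ∀ {ρ σ θ} → ρ ⨾ σ ≗ θ → ∀ C → (C ⟪ ρ ⟫c) ⟪ σ ⟫c ≡ C ⟪ θ ⟫c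
  ⟪⟫c-⨾ eq C = trans (sym (map-∘ C)) (map-cong (⟪⟫ₗ-⨾ eq) C)

  mutual
    ground? : ∀ t → Dec (Ground t)
    ground? (var x)    = no λ ground → ground x here
    ground? (fun f ts) =
      map′ (λ ground x → λ { (inside i x∈tᵢ) → ground i x x∈tᵢ })
           (λ ground i x x∈tᵢ → ground x (inside i x∈tᵢ))
           (ground*? ts)

    ground*? : ∀ {n} (ts : Vec Term n) → Dec (∀ i x → ¬ x occursIn lookup ts i)
    ground*? []       = yes λ ()
    ground*? (t ∷ ts) with ground? t | ground*? ts
    ... | no ¬gt | _       = no λ ground → ¬gt (ground zero)
    ... | yes _  | no ¬gts = no λ ground → ¬gts (ground ∘ suc)
    ... | yes gt | yes gts = yes λ { zero → gt ; (suc i) → gts i }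

module ClosureInstances (S : Signature) (ro : Terms.ReductionOrdering S)
                        (co : Terms.ClosureOrdering S ro) where
  open Terms S
  open Substitution S
  open ClosureOrders ro co renaming (trans to ≻tc-trans)

  instance-trans : ∀ {s t u} → ∃[ α ] t ⟪ α ⟫ ≡ s → ∃[ β ] u ⟪ β ⟫ ≡ t → ∃[ γ ] u ⟪ γ ⟫ ≡ s
  instance-trans {u = u} (α , tα≡s) (β , uβ≡t) =
    β ⨾ α , trans (sym (⟪⟫-⨾ (λ _ → refl) u)) (trans (cong (_⟪ α ⟫) uβ≡t) tα≡s)

  ≈tc-isEquivalence : IsEquivalence _≈tc_
  ≈tc-isEquivalence = record
    { refl  = λ {(s , _)} → refl , (id , ⟪id⟫ s) , (id , ⟪id⟫ s)
    ; sym   = λ (eq , t→s , s→t) → sym eq , s→t , t→s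
    ; trans = λ {(s , _)} {(t , _)} {(u , _)} (eq , t→s , s→t) (eq′ , u→t , t→u) →
                trans eq eq′ ,
                instance-trans {s} {t} {u} t→s u→t , instance-trans {u} {t} {s} t→u s→t
    }
  open IsEquivalence ≈tc-isEquivalence using ()
    renaming (sym to ≈tc-sym; reflexive to ≈tc-reflexive)

  ≈tc? : ∀ {x} → GroundTC x → ∀ y → Dec (x ≈tc y)
  ≈tc? {x} gx y with ground? (proj₁ y ⟪ proj₂ y ⟫)
  ... | no ¬gy = no λ (eq , _) → ¬gy (subst Ground eq gx)
  ... | yes gy with total {x} {y} gx gy
  ...   | inj₁ x≈y        = yes x≈y
  ...   | inj₂ (inj₁ x≻y) = no λ x≈y → irrefl x≈y x≻y
  ...   | inj₂ (inj₂ y≻x) = no λ x≈y → irrefl (≈tc-sym x≈y) y≻x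

  instance-⪰tc : ∀ {s σ t θ} → ∃[ ρ ] t ⟪ ρ ⟫ ≡ s → s ⟪ σ ⟫ ≡ t ⟪ θ ⟫ → Ground (s ⟪ σ ⟫) →
                 (s , σ) ⪰tc (t , θ)
  instance-⪰tc {s} {σ} {t} {θ} t→s same gs with total {s , σ} {t , θ} gs (subst Ground same gs)
  ... | inj₁ s≈t        = inj₂ s≈t
  ... | inj₂ (inj₁ s≻t) = inj₁ s≻t
  ... | inj₂ (inj₂ t≻s) =
    inj₁ (extends (gs , subst Ground same gs , inj₂ (same , t→s , not-variant)))
    where
    not-variant : ¬ (∃[ ρ′ ] s ⟪ ρ′ ⟫ ≡ t)
    not-variant s→t = irrefl (≈tc-sym (same , t→s , s→t)) t≻s

  ⪰tc-instance : ∀ t ρ σ θ → ρ ⨾ σ ≗ θ → Ground ((t ⟪ ρ ⟫) ⟪ σ ⟫) →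
                 (t ⟪ ρ ⟫ , σ) ⪰tc (t , θ)
  ⪰tc-instance t ρ σ θ eq = instance-⪰tc (ρ , refl) (⟪⟫-⨾ eq t)

  module TC = MultisetProperties _≈tc_ _≻tc_
  open PointwiseDomination _≈tc_ _≻tc_ GroundTC ≈tc-isEquivalence ≻tc-trans irrefl resp total
    using (pointwise-⪰⇒≻≻⊎≈ₘ)

  ground-id : ∀ {t} → Ground t → GroundTC (t , id)
  ground-id {t} = subst Ground (sym (⟪id⟫ t))

  GroundLC : LitClosure → Set
  GroundLC x = All GroundTC (Mlc x)

  Mlc-ground : ∀ L θ → GroundL (L ⟪ θ ⟫ₗ) → GroundLC (L , θ)
  Mlc-ground (pos s t) θ (gs , gt) = gs ∷ gt ∷ []
  Mlc-ground (neg s t) θ (gs , gt) = gs ∷ ground-id gs ∷ gt ∷ ground-id gt ∷ []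

  Mlc-⪰tc : ∀ L ρ σ θ → ρ ⨾ σ ≗ θ → GroundL ((L ⟪ ρ ⟫ₗ) ⟪ σ ⟫ₗ) →
            Pointwise _⪰tc_ (Mlc (L ⟪ ρ ⟫ₗ , σ)) (Mlc (L , θ))
  Mlc-⪰tc (pos s t) ρ σ θ eq (gs , gt) =
    ⪰tc-instance s ρ σ θ eq gs ∷ ⪰tc-instance t ρ σ θ eq gt ∷ []
  Mlc-⪰tc (neg s t) ρ σ θ eq (gs , gt) =
    ⪰tc-instance s ρ σ θ eq gs ∷ inj₂ (≈tc-reflexive (cong (_, id) (⟪⟫-⨾ eq s))) ∷
    ⪰tc-instance t ρ σ θ eq gt ∷ inj₂ (≈tc-reflexive (cong (_, id) (⟪⟫-⨾ eq t))) ∷ []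

  ⪰lc-instance : ∀ L ρ σ θ → ρ ⨾ σ ≗ θ → GroundL ((L ⟪ ρ ⟫ₗ) ⟪ σ ⟫ₗ) →
                 (L ⟪ ρ ⟫ₗ , σ) ⪰lc (L , θ)
  ⪰lc-instance L ρ σ θ eq g =
    pointwise-⪰⇒≻≻⊎≈ₘ (Mlc-ground (L ⟪ ρ ⟫ₗ) σ g) (Mlc-⪰tc L ρ σ θ eq g)

  count-in-ground : ∀ {M} → All GroundTC M → ∀ x → ∃[ n ] TC.Count x M n
  count-in-ground gM x = TC.count (All.map (λ gy → ≈tc? gy x) gM)

  count-of-ground : ∀ {x} → GroundTC x → ∀ M → ∃[ n ] TC.Count x M n
  count-of-ground gx = TC.count ∘ All.universal λ y → map′ ≈tc-sym ≈tc-sym (≈tc? gx y)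

  module LC = MultisetProperties _≈lc_ _≻lc_
  open LC using () renaming (_≻≻_ to _≻≻lc_; _≈ₘ_ to _≈ₘlc_)

  ≈lc-refl : ∀ {x} → x ≈lc x
  ≈lc-refl = TC.≈ₘ-reflexive refl

  ≈lc-sym : ∀ {x y} → x ≈lc y → y ≈lc x
  ≈lc-sym = TC.≈ₘ-sym

  ≈lc-trans : ∀ {x y z} → GroundLC y → x ≈lc y → y ≈lc z → x ≈lc z
  ≈lc-trans gy = TC.≈ₘ-trans (count-in-ground gy)

  ≻lc-respʳ-≈lc : ∀ {x y z} → GroundLC y → x ≻lc y → y ≈lc z → ¬ x ≈lc z → x ≻lc z
  ≻lc-respʳ-≈lc gy =
    TC.≻≻-respʳ-≈ₘ (count-in-ground gy) (λ w≻u → count-of-ground (proj₁ (ground w≻u)) _)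

  singleton-⪰cc : ∀ {x y} → GroundLC x → GroundLC y → x ⪰lc y →
                  [ x ] ≻≻lc [ y ] ⊎ [ x ] ≈ₘlc [ y ]
  singleton-⪰cc gx gy (inj₁ x≻y@(x≉y , _)) =
    inj₁ (LC.singleton-≻≻ ≈lc-refl x≉y (x≉y ∘ ≈lc-sym) (≻lc-respʳ-≈lc gy x≻y))
  singleton-⪰cc gx gy (inj₂ x≈y) =
    inj₂ (LC.singleton-≈ₘ (≈lc-trans gx (≈lc-sym x≈y)) (≈lc-trans gy x≈y))

  Mcc-instance : ∀ {ρ σ θ} → ρ ⨾ σ ≗ θ → ∀ C →
                 map (λ K → K ⟪ σ ⟫ₗ , id) (C ⟪ ρ ⟫c) ≡ map (λ K → K ⟪ θ ⟫ₗ , id) C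
  Mcc-instance eq C = trans (sym (map-∘ C)) (map-cong (cong (_, id) ∘ ⟪⟫ₗ-⨾ eq) C)

  ⪰cc-instance : ∀ C ρ σ θ → ρ ⨾ σ ≗ θ → GroundC ((C ⟪ ρ ⟫c) ⟪ σ ⟫c) →
                 (C ⟪ ρ ⟫c , σ) ⪰cc (C , θ)
  ⪰cc-instance [] ρ σ θ eq _ = inj₂ (LC.≈ₘ-reflexive refl)
  ⪰cc-instance (L ∷ []) ρ σ θ eq (gL ∷ []) =
    singleton-⪰cc (Mlc-ground (L ⟪ ρ ⟫ₗ) σ gL)
                  (Mlc-ground L θ (subst GroundL (⟪⟫ₗ-⨾ eq L) gL))
                  (⪰lc-instance L ρ σ θ eq gL)
  ⪰cc-instance C@(_ ∷ _ ∷ _) ρ σ θ eq _ = inj₂ (LC.≈ₘ-reflexive (Mcc-instance eq C))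

lemma4 : (S : Signature) → let open Terms S in
    (ro : ReductionOrdering) (co : ClosureOrdering ro) → let open ClosureOrders ro co in
    (∀ (t : Term) (ρ σ : Subst) → Ground ((t ⟪ ρ ⟫) ⟪ σ ⟫) →
        (t ⟪ ρ ⟫ , σ) ⪰tc (t , ρ ⨾ σ)) ×
    (∀ (L : Literal) (ρ σ : Subst) → GroundL ((L ⟪ ρ ⟫ₗ) ⟪ σ ⟫ₗ) →
        (L ⟪ ρ ⟫ₗ , σ) ⪰lc (L , ρ ⨾ σ)) ×
    (∀ (C : Clause) (ρ σ : Subst) → GroundC ((C ⟪ ρ ⟫c) ⟪ σ ⟫c) →
        (C ⟪ ρ ⟫c , σ) ⪰cc (C , ρ ⨾ σ)) ×
    (∀ (t : Term) (σ : Subst) → Ground (t ⟪ σ ⟫) →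
        (t ⟪ σ ⟫ , id) ⪰tc (t , σ)) ×
    (∀ (L : Literal) (σ : Subst) → GroundL (L ⟪ σ ⟫ₗ) →
        (L ⟪ σ ⟫ₗ , id) ⪰lc (L , σ)) ×
    (∀ (C : Clause) (σ : Subst) → GroundC (C ⟪ σ ⟫c) →
        (C ⟪ σ ⟫c , id) ⪰cc (C , σ))
lemma4 S ro co =
  (λ t ρ σ → ⪰tc-instance t ρ σ (ρ ⨾ σ) λ _ → refl) ,
  (λ L ρ σ → ⪰lc-instance L ρ σ (ρ ⨾ σ) λ _ → refl) ,
  (λ C ρ σ → ⪰cc-instance C ρ σ (ρ ⨾ σ) λ _ → refl) ,
  (λ t σ → ⪰tc-instance t σ id σ (⨾-identityʳ σ) ∘ subst Ground (sym (⟪⟫-⨾ (⨾-identityʳ σ) t))) ,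
  (λ L σ → ⪰lc-instance L σ id σ (⨾-identityʳ σ) ∘ subst GroundL (sym (⟪⟫ₗ-⨾ (⨾-identityʳ σ) L))) ,
  (λ C σ → ⪰cc-instance C σ id σ (⨾-identityʳ σ) ∘ subst GroundC (sym (⟪⟫c-⨾ (⨾-identityʳ σ) C)))
  where
  open Terms S
  open Substitution S
  open ClosureInstances S ro co
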